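{- Let $\mathsf{WL}$ be a W-logic and $\mathcal M^c=\langle W^c,\le^c,N^c,V^c\rangle$ its canonical model. Then for all $(\Sigma,\mathcal C)\in W^c$ and all formulas $A$ of $\mathcal L$: $\mathcal M^c,(\Sigma,\mathcal C)\Vdash A$ if and only if $A\in\Sigma$.
   Context: The language $\mathcal{L}$ consists of the formulas built from a countable set $\mathrm{Atm}$ of propositional variables by $A ::= p \mid \bot \mid A\land A \mid A\lor A \mid A\to A \mid \Box A \mid \Diamond A$; $\top := \bot\to\bot$, $\neg A := A\to\bot$. Axiom schemes and rules (for all $A,B$): (Mon$_\Box$) from $A\to B$ infer $\Box A\to\Box B$; (Mon$_\Diamond$) from $A\to B$ infer $\Diamond A\to\Diamond B$; (C$_\Box$) $\Box A\land\Box B\to\Box(A\land B)$; (K$_\Diamond$) $\Box(A\to B)\to(\Diamond A\to\Diamond B)$; (N$_\Box$) $\Box\top$; (T$_\Box$) $\Box A\to A$; (T$_\Diamond$) $A\to\Diamond A$; (D) $\Box A\to\Diamond A$; (P$_\Diamond$) $\Diamond\top$; (Dual$_\land$) $\neg(\Box A\land\Diamond\neg A)$. The W-logics are obtained by adding to an axiomatisation of intuitionistic propositional logic (all $\mathcal L$-instances, with modus ponens): $\mathsf{WM}$ := Dual$_\land$ + Mon$_\Box$ + Mon$_\Diamond$; $\mathsf{WMN}$ := $\mathsf{WM}$+N$_\Box$; $\mathsf{WMC}$ := $\mathsf{WM}$+C$_\Box$+K$_\Diamond$; $\mathsf{WK}$ := $\mathsf{WMC}$+N$_\Box$; $\mathsf{WMP}$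 := $\mathsf{WM}$+P$_\Diamond$; $\mathsf{WMNP}$ := $\mathsf{WMN}$+P$_\Diamond$; $\mathsf{WMD}$ := $\mathsf{WM}$+D+P$_\Diamond$; $\mathsf{WMND}$ := $\mathsf{WMN}$+D; $\mathsf{WMCD}$ := $\mathsf{WMC}$+D+P$_\Diamond$; $\mathsf{WKD}$ := $\mathsf{WK}$+D; $\mathsf{WMT}$, $\mathsf{WMNT}$, $\mathsf{WMCT}$, $\mathsf{WKT}$ := respectively $\mathsf{WM}$, $\mathsf{WMN}$, $\mathsf{WMC}$, $\mathsf{WK}$ + T$_\Box$ + T$_\Diamond$. $\mathsf{WL}\vdash A$ means $A$ is derivable from axiom instances of $\mathsf{WL}$ by modus ponens and rules of $\mathsf{WL}$; $\Sigma\vdash_{\mathsf{WL}}A$ means $\mathsf{WL}\vdash B_1\land\dots\land B_n\to A$ for some $B_1,\dots,B_n\in\Sigma$. $\Sigma$ is $\mathsf{WL}$-prime if $\Sigma\not\vdash_{\mathsf{WL}}\bot$, $\Sigma\vdash_{\mathsf{WL}}A$ implies $A\in\Sigma$, and $A\lor B\in\Sigma$ implies $A\in\Sigma$ or $B\in\Sigma$. A $\mathsf{WL}$-segment is a pair $(\Sigma,\mathcal C)$, $\Sigma$ $\mathsf{WL}$-prime and $\mathcal C$ a class of sets of $\mathsf{WL}$-prime sets, such that: if $\Box A\in\Sigma$ then some $\mathcal U\in\mathcal C$ has $A\in\Pi$ for all $\Pi\in\mathcal U$; if $\Diamond A\in\Sigma$ then every $\mathcal U\in\mathcal C$ has some $\Pi\in\mathcal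 U$ with $A\in\Pi$; if $\mathsf{WL}$ contains C$_\Box$, K$_\Diamond$: $\mathcal U,\mathcal U'\in\mathcal C\Rightarrow\mathcal U\cap\mathcal U'\in\mathcal C$; if $\mathsf{WL}$ contains D: $\mathcal U,\mathcal U'\in\mathcal C\Rightarrow\mathcal U\cap\mathcal U'\neq\emptyset$; if $\mathsf{WL}$ contains T$_\Box$, T$_\Diamond$: $\Sigma\in\mathcal U$ for all $\mathcal U\in\mathcal C$. The canonical model: $W^c$ is the class of all $\mathsf{WL}$-segments; $(\Sigma,\mathcal C)\le^c(\Sigma',\mathcal C')$ iff $\Sigma\subseteq\Sigma'$; for a set $\mathcal U$ of $\mathsf{WL}$-prime sets, $\alpha_{\mathcal U}=\{(\Sigma,\mathcal C)\in W^c:\Sigma\in\mathcal U\}$; $N^c((\Sigma,\mathcal C))=\{\alpha_{\mathcal U}:\mathcal U\in\mathcal C\}$; $(\Sigma,\mathcal C)\in V^c(p)$ iff $p\in\Sigma$. Forcing in a structure $\langle W,\le,N,V\rangle$: $w\Vdash p$ iff $w\in V(p)$; $w\not\Vdash\bot$; $\land,\lor$ pointwise; $w\Vdash B\to C$ iff for all $v\ge w$, $v\Vdash B$ implies $v\Vdash C$; $w\Vdash\Box B$ iff for all $v\ge w$ there is $\alpha\in N(v)$ with $u\Vdash B$ for all $u\in\alpha$; $w\Vdash\Diamond B$ iff for all $v\ge w$ and all $\alpha\in N(v)$ there is $u\in\alpha$ with $u\Vdash B$. -}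

module Defs where

open import Level using (Level; _⊔_) renaming (suc to lsuc; zero to lzero)
open import Data.Nat using (ℕ)
open import Data.Bool using (Bool; true; false; T)
open import Data.List using (List; []; _∷_)
open import Data.List.Relation.Unary.All using (All)
open import Data.Product using (Σ; Σ-syntax; ∃; _×_; _,_)
open import Data.Sum using (_⊎_)
open import Relation.Nullary using (¬_)
open import Function.Bundles using (_⇔_)

Atm : Set
Atm = ℕ

infixr 6 _∧'_
infixr 5 _∨'_
infixr 4 _⇒_

data Fm : Set where
  atom : Atm → Fm
  ⊥'   : Fm
  _∧'_ : Fm → Fm → Fm
  _∨'_ : Fm → Fm → Fm
  _⇒_  : Fm → Fm → Fm
  □    : Fm → Fm
  ◇    : Fm → Fm

⊤' : Fm
⊤' = ⊥' ⇒ ⊥'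

¬' : Fm → Fm
¬' A = A ⇒ ⊥'

data WLogic : Set where
  WM WMN WMC WK WMP WMNP WMD WMND WMCD WKD WMT WMNT WMCT WKT : WLogic

hasN : WLogic → Bool
hasN WMN  = true
hasN WK   = true
hasN WMNP = true
hasN WMND = true
hasN WKD  = true
hasN WMNT = true
hasN WKT  = true
hasN _    = false

hasC : WLogic → Bool
hasC WMC  = true
hasC WK   = true
hasC WMCD = true
hasC WKD  = true
hasC WMCT = true
hasC WKT  = true
hasC _    = false

hasD : WLogic → Bool
hasD WMD  = true
hasD WMND = true
hasD WMCD = true
hasD WKD  = true
hasD _    = false

hasP : WLogic → Bool
hasP WMP  = true
hasP WMNP = true
hasP WMD  = true
hasP WMCD = true
hasP _    = false

hasT : WLogic → Bool
hasT WMT  = true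
hasT WMNT = true
hasT WMCT = true
hasT WKT  = true
hasT _    = false

data _⊢_ (L : WLogic) : Fm → Set where
  ax-K   : ∀ {A B} → L ⊢ (A ⇒ B ⇒ A)
  ax-S   : ∀ {A B C} → L ⊢ ((A ⇒ B ⇒ C) ⇒ (A ⇒ B) ⇒ A ⇒ C)
  ax-∧i  : ∀ {A B} → L ⊢ (A ⇒ B ⇒ A ∧' B)
  ax-∧e₁ : ∀ {A B} → L ⊢ (A ∧' B ⇒ A)
  ax-∧e₂ : ∀ {A B} → L ⊢ (A ∧' B ⇒ B)
  ax-∨i₁ : ∀ {A B} → L ⊢ (A ⇒ A ∨' B)
  ax-∨i₂ : ∀ {A B} → L ⊢ (B ⇒ A ∨' B)
  ax-∨e  : ∀ {A B C} → L ⊢ ((A ⇒ C) ⇒ (B ⇒ C) ⇒ A ∨' B ⇒ C)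
  ax-efq : ∀ {A} → L ⊢ (⊥' ⇒ A)
  mp     : ∀ {A B} → L ⊢ (A ⇒ B) → L ⊢ A → L ⊢ B
  dual∧  : ∀ {A} → L ⊢ ¬' (□ A ∧' ◇ (¬' A))
  mon□   : ∀ {A B} → L ⊢ (A ⇒ B) → L ⊢ (□ A ⇒ □ B)
  mon◇   : ∀ {A B} → L ⊢ (A ⇒ B) → L ⊢ (◇ A ⇒ ◇ B)
  N□     : T (hasN L) → L ⊢ □ ⊤'
  C□     : ∀ {A B} → T (hasC L) → L ⊢ (□ A ∧' □ B ⇒ □ (A ∧' B))
  K◇     : ∀ {A B} → T (hasC L) → L ⊢ (□ (A ⇒ B) ⇒ ◇ A ⇒ ◇ B)
  D      : ∀ {A} → T (hasD L) → L ⊢ (□ A ⇒ ◇ A)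
  P◇     : T (hasP L) → L ⊢ ◇ ⊤'
  T□     : ∀ {A} → T (hasT L) → L ⊢ (□ A ⇒ A)
  T◇     : ∀ {A} → T (hasT L) → L ⊢ (A ⇒ ◇ A)

FmSet : Set₁
FmSet = Fm → Set

⋀ : List Fm → Fm
⋀ []       = ⊤'
⋀ (B ∷ Bs) = B ∧' ⋀ Bs

_⊢[_]_ : FmSet → WLogic → Fm → Set
Γ ⊢[ L ] A = Σ[ Bs ∈ List Fm ] (All Γ Bs × L ⊢ (⋀ Bs ⇒ A))

record Prime (L : WLogic) (Γ : FmSet) : Set where
  field
    consistent : ¬ (Γ ⊢[ L ] ⊥')
    closed     : ∀ {A} → Γ ⊢[ L ] A → Γ A
    disj       : ∀ {A B} → Γ (A ∨' B) → Γ A ⊎ Γ B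

SetOfSets : Set₁
SetOfSets = FmSet → Set

ClassOfSets : Set₁
ClassOfSets = SetOfSets → Set

record Segment (L : WLogic) : Set₁ where
  field
    Σ₀      : FmSet
    𝒞       : ClassOfSets
    primeΣ  : Prime L Σ₀
    primeU  : ∀ 𝒰 → 𝒞 𝒰 → ∀ Π → 𝒰 Π → Prime L Π
    box     : ∀ A → Σ₀ (□ A) → Σ[ 𝒰 ∈ SetOfSets ] (𝒞 𝒰 × (∀ Π → 𝒰 Π → Π A))
    dia     : ∀ A → Σ₀ (◇ A) → ∀ 𝒰 → 𝒞 𝒰 → Σ[ Π ∈ FmSet ] (𝒰 Π × Π A)
    inter   : T (hasC L) → ∀ 𝒰 𝒰′ → 𝒞 𝒰 → 𝒞 𝒰′ →
              Σ[ 𝒰″ ∈ SetOfSets ] (𝒞 𝒰″ × (∀ Π → 𝒰″ Π ⇔ (𝒰 Π × 𝒰′ Π)))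
    nonempt : T (hasD L) → ∀ 𝒰 𝒰′ → 𝒞 𝒰 → 𝒞 𝒰′ → Σ[ Π ∈ FmSet ] (𝒰 Π × 𝒰′ Π)
    refl∈   : T (hasT L) → ∀ 𝒰 → 𝒞 𝒰 → 𝒰 Σ₀

-- Intuitionistic neighbourhood structures ⟨W, ≤, N, V⟩.
-- N(w) is given as an indexed family of neighbourhoods:
-- α ∈ N(w) iff α = nb w i for some i : Nb w.

record Structure (a r n m v : Level) : Set (lsuc (a ⊔ r ⊔ n ⊔ m ⊔ v)) where
  field
    W   : Set a
    _≤_ : W → W → Set r
    Nb  : W → Set n
    nb  : (w : W) → Nb w → W → Set m
    V   : Atm → W → Set v

module _ {a r n m v : Level} (M : Structure a r n m v) where
  open Structure M

  _⊩_ : W → Fm → Set (a ⊔ r ⊔ n ⊔ m ⊔ v)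
  w ⊩ atom p  = Level.Lift (a ⊔ r ⊔ n ⊔ m) (V p w)
  w ⊩ ⊥'      = Level.Lift (a ⊔ r ⊔ n ⊔ m ⊔ v) Data.Empty.⊥
    where import Data.Empty
  w ⊩ (B ∧' C) = (w ⊩ B) × (w ⊩ C)
  w ⊩ (B ∨' C) = (w ⊩ B) ⊎ (w ⊩ C)
  w ⊩ (B ⇒ C)  = ∀ u → w ≤ u → u ⊩ B → u ⊩ C
  w ⊩ □ B      = ∀ u → w ≤ u → Σ[ i ∈ Nb u ] (∀ x → nb u i x → x ⊩ B)
  w ⊩ ◇ B      = ∀ u → w ≤ u → ∀ (i : Nb u) → Σ[ x ∈ W ] (nb u i x × x ⊩ B)

Canonical : (L : WLogic) → Structure (lsuc lzero) lzero (lsuc lzero) lzero lzero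
Canonical L = record
  { W   = Segment L
  ; _≤_ = λ w w′ → ∀ A → Segment.Σ₀ w A → Segment.Σ₀ w′ A
  ; Nb  = λ w → Σ[ 𝒰 ∈ SetOfSets ] Segment.𝒞 w 𝒰
  ; nb  = λ w i x → Data.Product.proj₁ i (Segment.Σ₀ x)
  ; V   = λ p w → Segment.Σ₀ w (atom p)
  }
  where import Data.Product

module Submission where

-- By induction on A; membership implies forcing directly by the segment conditions. Conversely,
-- let the formula be outside Σ. For B ⇒ C, Lindenbaum's lemma gives a prime Δ ⊇ Σ ∪ {B} omitting C,
-- and every segment over Δ lies above w. For □ B, take the segment over Σ whose neighbourhoods are,
-- for □ A ∈ Σ, the primes containing A: each contains a prime omitting B, for A ⊢ B would put □ B
-- in Σ by Mon□. For ◇ B, add the primes omitting B as a further neighbourhood. These are segments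
-- because for ◇ C ∈ Σ each neighbourhood "primes containing A and omitting X" has a member
-- containing C: otherwise A, C ⊢ X, contradicting Dual∧ when X = ⊥ and ◇ B ∉ Σ (via Mon◇ or K◇)
-- when X = B.

open import Defs
open import Axiom.ExcludedMiddle using (ExcludedMiddle)
open import Axiom.DoubleNegationElimination using (em⇒dne)
open import Level using (lift; lower; 0ℓ)
open import Function using (id; _∘_; case_of_)
open import Function.Bundles using (_⇔_; mk⇔; Equivalence)
open import Function.Construct.Identity using (⇔-id)
open import Function.Construct.Symmetry using (⇔-sym)
open import Function.Construct.Composition using (_⇔-∘_)
open import Data.Product.Function.NonDependent.Propositional using (_×-⇔_)
open import Data.Bool using (T)
open import Data.Nat using (ℕ; zero; suc; _⊔_; _≤′_; ≤′-refl; ≤′-step)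
open import Data.Nat.Properties using (≤⇒≤′; m≤m⊔n; m≤n⊔m)
open import Data.List using (List; []; _∷_; _++_; map; foldl; concatMap; cartesianProductWith)
open import Data.List.Relation.Unary.All as All using (All; []; _∷_)
open import Data.List.Relation.Unary.All.Properties using (++⁺)
open import Data.List.Relation.Unary.Any as Any using (here; there)
open import Data.List.Membership.Propositional using (_∈_)
open import Data.List.Membership.Propositional.Properties
  using (∈-++⁺ˡ; ∈-++⁺ʳ; ∈-map⁺; ∈-concatMap⁺; ∈-cartesianProductWith⁺)
open import Data.Product using (Σ-syntax; ∃; _×_; _,_; proj₁; proj₂)
open import Data.Sum as Sum using (_⊎_; inj₁; inj₂; [_,_])
open import Data.Empty using (⊥; ⊥-elim)
open import Data.Unit using (⊤; tt)
open import Relation.Nullary using (¬_; yes; no)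
open import Relation.Nullary.Decidable using (True; toWitness; fromWitness)
open import Relation.Unary using (∅; ｛_｝; _∪_; _⊆_)
open import Relation.Binary.PropositionalEquality using (_≡_; refl)

module Derivations (L : WLogic) where

  infix 3 _⊢ʰ_

  data _⊢ʰ_ (Γ : List Fm) : Fm → Set where
    hyp : ∀ {A} → A ∈ Γ → Γ ⊢ʰ A
    thm : ∀ {A} → L ⊢ A → Γ ⊢ʰ A
    app : ∀ {A B} → Γ ⊢ʰ (A ⇒ B) → Γ ⊢ʰ A → Γ ⊢ʰ B

  ⊢-id : ∀ {A} → L ⊢ (A ⇒ A)
  ⊢-id {A} = mp (mp (ax-S {B = A ⇒ A}) ax-K) ax-K

  ⊢ʰ-lam : ∀ {Γ A B} → A ∷ Γ ⊢ʰ B → Γ ⊢ʰ (A ⇒ B)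
  ⊢ʰ-lam (hyp (here refl)) = thm ⊢-id
  ⊢ʰ-lam (hyp (there p))   = app (thm ax-K) (hyp p)
  ⊢ʰ-lam (thm p)           = app (thm ax-K) (thm p)
  ⊢ʰ-lam (app d e)         = app (app (thm ax-S) (⊢ʰ-lam d)) (⊢ʰ-lam e)

  ⊢ʰ-subst : ∀ {Γ Δ A} → Γ ⊢ʰ A → (∀ {B} → B ∈ Γ → Δ ⊢ʰ B) → Δ ⊢ʰ A
  ⊢ʰ-subst (hyp p)   σ = σ p
  ⊢ʰ-subst (thm p)   σ = thm p
  ⊢ʰ-subst (app d e) σ = app (⊢ʰ-subst d σ) (⊢ʰ-subst e σ)

  ⊢ʰ-weaken : ∀ {Γ Δ A} → Γ ⊢ʰ A → (∀ {B} → B ∈ Γ → B ∈ Δ) → Δ ⊢ʰ A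
  ⊢ʰ-weaken d ρ = ⊢ʰ-subst d (hyp ∘ ρ)

  ⊢ʰ-closed : ∀ {A} → [] ⊢ʰ A → L ⊢ A
  ⊢ʰ-closed (thm p)   = p
  ⊢ʰ-closed (app d e) = mp (⊢ʰ-closed d) (⊢ʰ-closed e)

  ⋀-elim : ∀ {Γ Δ A} → A ∈ Γ → Δ ⊢ʰ ⋀ Γ → Δ ⊢ʰ A
  ⋀-elim (here refl) d = app (thm ax-∧e₁) d
  ⋀-elim (there p)   d = ⋀-elim p (app (thm ax-∧e₂) d)

  ⋀-intro : ∀ {Γ} Bs → (∀ {B} → B ∈ Bs → Γ ⊢ʰ B) → Γ ⊢ʰ ⋀ Bs
  ⋀-intro []       ds = thm ⊢-id
  ⋀-intro (B ∷ Bs) ds = app (app (thm ax-∧i) (ds (here refl))) (⋀-intro Bs (ds ∘ there))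

  ⊢-¬¬-intro : ∀ {A} → L ⊢ (A ⇒ ¬' (¬' A))
  ⊢-¬¬-intro = ⊢ʰ-closed (⊢ʰ-lam (⊢ʰ-lam (app (hyp (here refl)) (hyp (there (here refl))))))

  ⊢-∧-introʳ : ∀ {A B} → L ⊢ B → L ⊢ (A ⇒ A ∧' B)
  ⊢-∧-introʳ ⊢B = ⊢ʰ-closed (⊢ʰ-lam (app (app (thm ax-∧i) (hyp (here refl))) (thm ⊢B)))

  ⊢ʰ⇒⊢⋀ : ∀ {Γ A} → Γ ⊢ʰ A → L ⊢ (⋀ Γ ⇒ A)
  ⊢ʰ⇒⊢⋀ d = ⊢ʰ-closed (⊢ʰ-lam (⊢ʰ-subst d (λ p → ⋀-elim p (hyp (here refl)))))

  ⊢⋀⇒⊢ʰ : ∀ {Γ A} → L ⊢ (⋀ Γ ⇒ A) → Γ ⊢ʰ A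
  ⊢⋀⇒⊢ʰ {Γ} p = app (thm p) (⋀-intro Γ hyp)

  ∈⇒⊢ : ∀ {Γ A} → Γ A → Γ ⊢[ L ] A
  ∈⇒⊢ {A = A} a = A ∷ [] , a ∷ [] , ax-∧e₁

  theorem⇒⊢ : ∀ {Γ A} → L ⊢ A → Γ ⊢[ L ] A
  theorem⇒⊢ p = [] , [] , mp ax-K p

  ⊢-mp : ∀ {Γ A B} → Γ ⊢[ L ] (A ⇒ B) → Γ ⊢[ L ] A → Γ ⊢[ L ] B
  ⊢-mp (Bs , Bs∈Γ , p) (Cs , Cs∈Γ , q) =
    Bs ++ Cs , ++⁺ Bs∈Γ Cs∈Γ ,
    ⊢ʰ⇒⊢⋀ (app (⊢ʰ-weaken (⊢⋀⇒⊢ʰ p) ∈-++⁺ˡ) (⊢ʰ-weaken (⊢⋀⇒⊢ʰ q) (∈-++⁺ʳ Bs)))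

  ⊢-mono : ∀ {Γ Δ A} → Γ ⊆ Δ → Γ ⊢[ L ] A → Δ ⊢[ L ] A
  ⊢-mono Γ⊆Δ (Bs , Bs∈Γ , p) = Bs , All.map Γ⊆Δ Bs∈Γ , p

  private
    discharge : ∀ {Γ : FmSet} {B} Bs → All (Γ ∪ ｛ B ｝) Bs →
                Σ[ Bs′ ∈ List Fm ] (All Γ Bs′ × (∀ {X} → X ∈ Bs → X ∈ B ∷ Bs′))
    discharge []       []               = [] , [] , λ ()
    discharge (X ∷ Bs) (inj₂ refl ∷ Bs∈) with discharge Bs Bs∈
    ... | Bs′ , Bs′∈Γ , ⊆B∷Bs′ = Bs′ , Bs′∈Γ , λ where
      (here refl) → here refl
      (there p)   → ⊆B∷Bs′ p
    discharge (X ∷ Bs) (inj₁ X∈Γ ∷ Bs∈) with discharge Bs Bs∈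
    ... | Bs′ , Bs′∈Γ , ⊆B∷Bs′ = X ∷ Bs′ , X∈Γ ∷ Bs′∈Γ , λ where
      (here refl) → there (here refl)
      (there p)   → case ⊆B∷Bs′ p of λ where
        (here q)  → here q
        (there q) → there (there q)

  ⊢-deduction : ∀ {Γ B C} → (Γ ∪ ｛ B ｝) ⊢[ L ] C → Γ ⊢[ L ] (B ⇒ C)
  ⊢-deduction (Bs , Bs∈ , p) with discharge Bs Bs∈
  ... | Bs′ , Bs′∈Γ , ⊆B∷Bs′ = Bs′ , Bs′∈Γ , ⊢ʰ⇒⊢⋀ (⊢ʰ-lam (⊢ʰ-weaken (⊢⋀⇒⊢ʰ p) ⊆B∷Bs′))

  ∅⊢⇒⊢ : ∀ {A} → ∅ ⊢[ L ] A → L ⊢ A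
  ∅⊢⇒⊢ ([] , [] , p) = mp p ⊢-id

  singleton-deduction : ∀ {A B} → ｛ A ｝ ⊢[ L ] B → L ⊢ (A ⇒ B)
  singleton-deduction d = ∅⊢⇒⊢ (⊢-deduction (⊢-mono inj₂ d))

  pair-deduction : ∀ {A B C} → (｛ A ｝ ∪ ｛ B ｝) ⊢[ L ] C → L ⊢ (A ⇒ B ⇒ C)
  pair-deduction d = singleton-deduction (⊢-deduction d)

module PrimeSet {L : WLogic} {Π : FmSet} (Π-prime : Prime L Π) where
  open Derivations L
  open Prime Π-prime

  ∈-theorem : ∀ {A} → L ⊢ A → Π A
  ∈-theorem p = closed (theorem⇒⊢ p)

  ∈-mp : ∀ {A B} → Π (A ⇒ B) → Π A → Π B
  ∈-mp f a = closed (⊢-mp (∈⇒⊢ f) (∈⇒⊢ a))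

  ∈-imp : ∀ {A B} → L ⊢ (A ⇒ B) → Π A → Π B
  ∈-imp p = ∈-mp (∈-theorem p)

  ∈-∧ : ∀ {A B} → Π A → Π B → Π (A ∧' B)
  ∈-∧ a = ∈-mp (∈-imp ax-∧i a)

  ∉-⊥ : ¬ Π ⊥'
  ∉-⊥ b = consistent (∈⇒⊢ b)

unaries : List (Fm → Fm)
unaries = □ ∷ ◇ ∷ []

binaries : List (Fm → Fm → Fm)
binaries = _∧'_ ∷ _∨'_ ∷ _⇒_ ∷ []

applyUnaries : List Fm → List Fm
applyUnaries Xs = concatMap (λ f → map f Xs) unaries

applyBinaries : List Fm → List Fm
applyBinaries Xs = concatMap (λ f → cartesianProductWith f Xs Xs) binaries

∈-applyUnaries : ∀ {f Xs A} → f ∈ unaries → A ∈ Xs → f A ∈ applyUnaries Xs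
∈-applyUnaries {Xs = Xs} f∈ A∈ =
  ∈-concatMap⁺ (λ g → map g Xs) (Any.map (λ where refl → ∈-map⁺ _ A∈) f∈)

∈-applyBinaries : ∀ {f Xs A B} → f ∈ binaries → A ∈ Xs → B ∈ Xs → f A B ∈ applyBinaries Xs
∈-applyBinaries {Xs = Xs} f∈ A∈ B∈ =
  ∈-concatMap⁺ (λ g → cartesianProductWith g Xs Xs)
    (Any.map (λ where refl → ∈-cartesianProductWith⁺ _ A∈ B∈) f∈)

formulas : ℕ → List Fm
formulas zero    = ⊥' ∷ []
formulas (suc n) = formulas n ++ atom n ∷ applyUnaries (formulas n) ++ applyBinaries (formulas n)

formulas-mono : ∀ {m n A} → m ≤′ n → A ∈ formulas m → A ∈ formulas n
formulas-mono ≤′-refl       A∈ = A∈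
formulas-mono (≤′-step m≤n) A∈ = ∈-++⁺ˡ (formulas-mono m≤n A∈)

private
  complete₁ : ∀ {f} → f ∈ unaries → ∀ {A} →
              ∃ (λ n → A ∈ formulas n) → ∃ (λ n → f A ∈ formulas n)
  complete₁ f∈ (n , A∈) =
    suc n , ∈-++⁺ʳ (formulas n) (there (∈-++⁺ˡ (∈-applyUnaries f∈ A∈)))

  complete₂ : ∀ {f} → f ∈ binaries → ∀ {A B} →
              ∃ (λ n → A ∈ formulas n) → ∃ (λ n → B ∈ formulas n) →
              ∃ (λ n → f A B ∈ formulas n)
  complete₂ f∈ (m , A∈) (n , B∈) =
    suc k , ∈-++⁺ʳ (formulas k) (there (∈-++⁺ʳ (applyUnaries (formulas k))
      (∈-applyBinaries f∈ (formulas-mono (≤⇒≤′ (m≤m⊔n m n)) A∈)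
                          (formulas-mono (≤⇒≤′ (m≤n⊔m m n)) B∈))))
    where
    k : ℕ
    k = m ⊔ n

formulas-complete : ∀ A → ∃ λ n → A ∈ formulas n
formulas-complete (atom p) = suc p , ∈-++⁺ʳ (formulas p) (here refl)
formulas-complete ⊥'       = zero , here refl
formulas-complete (A ∧' B) = complete₂ (here refl) (formulas-complete A) (formulas-complete B)
formulas-complete (A ∨' B) =
  complete₂ (there (here refl)) (formulas-complete A) (formulas-complete B)
formulas-complete (A ⇒ B)  =
  complete₂ (there (there (here refl))) (formulas-complete A) (formulas-complete B)
formulas-complete (□ A)    = complete₁ (here refl) (formulas-complete A)
formulas-complete (◇ A)    = complete₁ (there (here refl)) (formulas-complete A)

module Lindenbaum {L : WLogic} (em : ExcludedMiddle 0ℓ) (Γ : FmSet) (C : Fm) where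
  open Derivations L

  Avoids : FmSet → Set
  Avoids Δ = ¬ (Δ ⊢[ L ] C)

  insert : FmSet → Fm → FmSet
  insert Δ x = Δ ∪ (λ A → x ≡ A × Avoids (Δ ∪ ｛ x ｝))

  insertAll : FmSet → List Fm → FmSet
  insertAll = foldl insert

  stage : ℕ → FmSet
  stage zero    = Γ
  stage (suc n) = insertAll (stage n) (formulas n)

  limit : FmSet
  limit A = ∃ λ n → stage n A

  ⊆-insertAll : ∀ {Δ} xs → Δ ⊆ insertAll Δ xs
  ⊆-insertAll []       A∈ = A∈
  ⊆-insertAll (x ∷ xs) A∈ = ⊆-insertAll xs (inj₁ A∈)

  stage-mono : ∀ {m n} → m ≤′ n → stage m ⊆ stage n
  stage-mono ≤′-refl            A∈ = A∈
  stage-mono (≤′-step {n} m≤n) A∈ = ⊆-insertAll (formulas n) (stage-mono m≤n A∈)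

  insert-avoids : ∀ {Δ x} → Avoids Δ → Avoids (insert Δ x)
  insert-avoids {Δ} {x} Δ⊬C ⊢C with em {(Δ ∪ ｛ x ｝) ⊢[ L ] C}
  ... | yes Δx⊢C = Δ⊬C (⊢-mono [ id , (λ (_ , Δx⊬C) → ⊥-elim (Δx⊬C Δx⊢C)) ] ⊢C)
  ... | no  Δx⊬C = Δx⊬C (⊢-mono (Sum.map₂ proj₁) ⊢C)

  insertAll-avoids : ∀ {Δ} xs → Avoids Δ → Avoids (insertAll Δ xs)
  insertAll-avoids []       Δ⊬C = Δ⊬C
  insertAll-avoids (x ∷ xs) Δ⊬C = insertAll-avoids xs (insert-avoids Δ⊬C)

  stage-avoids : Avoids Γ → ∀ n → Avoids (stage n)
  stage-avoids Γ⊬C zero    = Γ⊬C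
  stage-avoids Γ⊬C (suc n) = insertAll-avoids (formulas n) (stage-avoids Γ⊬C n)

  All-limit⇒stage : ∀ {Bs} → All limit Bs → ∃ λ n → All (stage n) Bs
  All-limit⇒stage []                = zero , []
  All-limit⇒stage ((m , B∈) ∷ Bs∈) with All-limit⇒stage Bs∈
  ... | n , Bs∈′ =
    m ⊔ n , stage-mono (≤⇒≤′ (m≤m⊔n m n)) B∈ ∷ All.map (stage-mono (≤⇒≤′ (m≤n⊔m m n))) Bs∈′

  limit-avoids : Avoids Γ → Avoids limit
  limit-avoids Γ⊬C (Bs , Bs∈ , p) with All-limit⇒stage Bs∈
  ... | n , Bs∈′ = stage-avoids Γ⊬C n (Bs , Bs∈′ , p)

  insertAll-decides : ∀ {Δ x} xs → x ∈ xs →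
                      insertAll Δ xs x ⊎ (insertAll Δ xs ∪ ｛ x ｝) ⊢[ L ] C
  insertAll-decides {Δ} {x} (x ∷ xs) (here refl) with em {(Δ ∪ ｛ x ｝) ⊢[ L ] C}
  ... | yes Δx⊢C = inj₂ (⊢-mono (Sum.map₁ (⊆-insertAll xs ∘ inj₁)) Δx⊢C)
  ... | no  Δx⊬C = inj₁ (⊆-insertAll xs (inj₂ (refl , Δx⊬C)))
  insertAll-decides (y ∷ xs) (there x∈) = insertAll-decides xs x∈

  limit-decides : ∀ A → limit A ⊎ (limit ∪ ｛ A ｝) ⊢[ L ] C
  limit-decides A with formulas-complete A
  ... | n , A∈ with insertAll-decides (formulas n) A∈
  ...   | inj₁ A∈stage = inj₁ (suc n , A∈stage)
  ...   | inj₂ ⊢C      = inj₂ (⊢-mono (Sum.map₁ (suc n ,_)) ⊢C)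

  limit-prime : Avoids Γ → Prime L limit
  limit-prime Γ⊬C = record { consistent = consistent ; closed = closed ; disj = disj }
    where
    ⊬C : Avoids limit
    ⊬C = limit-avoids Γ⊬C

    consistent : ¬ (limit ⊢[ L ] ⊥')
    consistent ⊢⊥ = ⊬C (⊢-mp (theorem⇒⊢ ax-efq) ⊢⊥)

    closed : ∀ {A} → limit ⊢[ L ] A → limit A
    closed {A} ⊢A with limit-decides A
    ... | inj₁ A∈  = A∈
    ... | inj₂ A⊢C = ⊥-elim (⊬C (⊢-mp (⊢-deduction A⊢C) ⊢A))

    disj : ∀ {A B} → limit (A ∨' B) → limit A ⊎ limit B
    disj {A} {B} A∨B∈ with limit-decides A | limit-decides B
    ... | inj₁ A∈  | _        = inj₁ A∈
    ... | inj₂ _   | inj₁ B∈  = inj₂ B∈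
    ... | inj₂ A⊢C | inj₂ B⊢C =
      ⊥-elim (⊬C (⊢-mp (⊢-mp (⊢-mp (theorem⇒⊢ ax-∨e) (⊢-deduction A⊢C)) (⊢-deduction B⊢C))
                        (∈⇒⊢ A∨B∈)))

lindenbaum : ∀ {L} → ExcludedMiddle 0ℓ → ∀ {Γ C} → ¬ (Γ ⊢[ L ] C) →
             Σ[ Δ ∈ FmSet ] (Prime L Δ × Γ ⊆ Δ × ¬ Δ C)
lindenbaum {L} em {Γ} {C} Γ⊬C =
  limit , limit-prime Γ⊬C , (zero ,_) , limit-avoids Γ⊬C ∘ Derivations.∈⇒⊢ L
  where open Lindenbaum em Γ C

⊢◇⊤ : ∀ {L} → T (hasD L) → L ⊢ ◇ ⊤'
⊢◇⊤ {WMD}  _ = P◇ tt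
⊢◇⊤ {WMND} _ = mp (D tt) (N□ tt)
⊢◇⊤ {WMCD} _ = P◇ tt
⊢◇⊤ {WKD}  _ = mp (D tt) (N□ tt)

module CanonicalSegments (L : WLogic) (em : ∀ {ℓ} → ExcludedMiddle ℓ) where
  open Derivations L

  ⟦_,_⟧ : Fm → Fm → SetOfSets
  ⟦ A , X ⟧ Π = Prime L Π × Π A × ¬ Π X

  ⟦∧⟧⇔ : ∀ {A A′ X X′ X″ Π} → (Prime L Π → (¬ Π X″) ⇔ (¬ Π X × ¬ Π X′)) →
         ⟦ A ∧' A′ , X″ ⟧ Π ⇔ (⟦ A , X ⟧ Π × ⟦ A′ , X′ ⟧ Π)
  ⟦∧⟧⇔ {A} {A′} {X} {X′} {X″} {Π} X″⇔ = mk⇔ split join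
    where
    split : ⟦ A ∧' A′ , X″ ⟧ Π → ⟦ A , X ⟧ Π × ⟦ A′ , X′ ⟧ Π
    split (Π-prime , A∧A′∈ , X″∉) =
      let open PrimeSet Π-prime
          (X∉ , X′∉) = Equivalence.to (X″⇔ Π-prime) X″∉
      in (Π-prime , ∈-imp ax-∧e₁ A∧A′∈ , X∉) , (Π-prime , ∈-imp ax-∧e₂ A∧A′∈ , X′∉)

    join : ⟦ A , X ⟧ Π × ⟦ A′ , X′ ⟧ Π → ⟦ A ∧' A′ , X″ ⟧ Π
    join ((Π-prime , A∈ , X∉) , (_ , A′∈ , X′∉)) =
      Π-prime , PrimeSet.∈-∧ Π-prime A∈ A′∈ , Equivalence.from (X″⇔ Π-prime) (X∉ , X′∉)

  -- With Refuted empty the neighbourhoods are the ⟦ A , ⊥' ⟧ with □ A ∈ S; given Refuted (so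
  -- ◇ B ∉ S) there are also the ⟦ A , B ⟧ with A a theorem or, in logics with C□ and K◇, □ A ∈ S,
  -- which keeps the class closed under intersection.
  module Construction {S : FmSet} (S-prime : Prime L S)
                      (B : Fm) (Refuted : Set) (refuted : Refuted → ¬ S (◇ B)) where
    open PrimeSet S-prime

    Boxed : Fm → Set
    Boxed A = L ⊢ A ⊎ (T (hasC L) × S (□ A))

    Boxed-∧ : ∀ {A A′} → Boxed A → Boxed A′ → Boxed (A ∧' A′)
    Boxed-∧ (inj₁ ⊢A)       (inj₁ ⊢A′)       = inj₁ (mp (mp ax-∧i ⊢A) ⊢A′)
    Boxed-∧ (inj₁ ⊢A)       (inj₂ (c , □A′)) = inj₂ (c , ∈-imp (mon□ (mp ax-∧i ⊢A)) □A′)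
    Boxed-∧ (inj₂ (c , □A)) (inj₁ ⊢A′)       = inj₂ (c , ∈-imp (mon□ (⊢-∧-introʳ ⊢A′)) □A)
    Boxed-∧ (inj₂ (c , □A)) (inj₂ (_ , □A′)) = inj₂ (c , ∈-imp (C□ c) (∈-∧ □A □A′))

    data Admissible : Fm → Fm → Set where
      boxed    : ∀ {A} → S (□ A) → Admissible A ⊥'
      avoiding : ∀ {A} → Refuted → Boxed A → Admissible A B

    admissible-excludes : ∀ {A X Π} → Admissible A X → Prime L Π → ¬ Π B → ¬ Π X
    admissible-excludes (boxed _)      Π-prime _  = PrimeSet.∉-⊥ Π-prime
    admissible-excludes (avoiding _ _) _       B∉ = B∉

    admissible-⊬ : ∀ {A X C} → Admissible A X → S (◇ C) → ¬ ((｛ A ｝ ∪ ｛ C ｝) ⊢[ L ] X)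
    admissible-⊬ {C = C} adm ◇C ⊢X = contradiction adm (pair-deduction ⊢X)
      where
      contradiction : ∀ {A X} → Admissible A X → ¬ (L ⊢ (A ⇒ C ⇒ X))
      contradiction (boxed □A) ⊢A⇒¬C =
        ∉-⊥ (∈-mp (∈-theorem dual∧) (∈-∧ (∈-imp (mon□ ⊢A⇒¬C) □A) (∈-imp (mon◇ ⊢-¬¬-intro) ◇C)))
      contradiction (avoiding r (inj₁ ⊢A)) ⊢A⇒C⇒B =
        refuted r (∈-imp (mon◇ (mp ⊢A⇒C⇒B ⊢A)) ◇C)
      contradiction (avoiding r (inj₂ (c , □A))) ⊢A⇒C⇒B =
        refuted r (∈-mp (∈-mp (∈-theorem (K◇ c)) (∈-imp (mon□ ⊢A⇒C⇒B) □A)) ◇C)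

    admissible-witness : ∀ {A X C} → Admissible A X → S (◇ C) →
                         Σ[ Π ∈ FmSet ] (⟦ A , X ⟧ Π × Π C)
    admissible-witness adm ◇C with lindenbaum em (admissible-⊬ adm ◇C)
    ... | Π , Π-prime , ⊆Π , X∉ = Π , (Π-prime , ⊆Π (inj₁ refl) , X∉) , ⊆Π (inj₂ refl)

    admissible-∩ : T (hasC L) → ∀ {A A′ X X′} → Admissible A X → Admissible A′ X′ →
                   Σ[ X″ ∈ Fm ] (Admissible (A ∧' A′) X″ ×
                                 (∀ {Π} → Prime L Π → (¬ Π X″) ⇔ (¬ Π X × ¬ Π X′)))
    admissible-∩ c (boxed □A) (boxed □A′) =
      ⊥' , boxed (∈-imp (C□ c) (∈-∧ □A □A′)) , λ _ → mk⇔ (λ ⊥∉ → ⊥∉ , ⊥∉) proj₁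
    admissible-∩ c (boxed □A) (avoiding r A′) =
      B , avoiding r (Boxed-∧ (inj₂ (c , □A)) A′) , λ Π-prime → mk⇔ (PrimeSet.∉-⊥ Π-prime ,_) proj₂
    admissible-∩ c (avoiding r A) (boxed □A′) =
      B , avoiding r (Boxed-∧ A (inj₂ (c , □A′))) , λ Π-prime → mk⇔ (_, PrimeSet.∉-⊥ Π-prime) proj₁
    admissible-∩ c (avoiding r A) (avoiding _ A′) =
      B , avoiding r (Boxed-∧ A A′) , λ _ → mk⇔ (λ B∉ → B∉ , B∉) proj₁

    admissible-◇ : T (hasD L) → ∀ {A X} → Admissible A X → S (◇ A)
    admissible-◇ d (boxed □A)                   = ∈-imp (D d) □A
    admissible-◇ d (avoiding _ (inj₁ ⊢A))       = ∈-imp (mon◇ (mp ax-K ⊢A)) (∈-theorem (⊢◇⊤ d))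
    admissible-◇ d (avoiding _ (inj₂ (_ , □A))) = ∈-imp (D d) □A

    admissible-meet : T (hasD L) → ∀ {A A′ X X′} → Admissible A X → Admissible A′ X′ →
                      Σ[ Π ∈ FmSet ] (⟦ A , X ⟧ Π × ⟦ A′ , X′ ⟧ Π)
    admissible-meet d (boxed □A) adm′ with admissible-witness adm′ (admissible-◇ d (boxed □A))
    ... | Π , (Π-prime , A′∈ , X′∉) , A∈ =
      Π , (Π-prime , A∈ , PrimeSet.∉-⊥ Π-prime) , (Π-prime , A′∈ , X′∉)
    admissible-meet d adm@(avoiding _ _) adm′ with admissible-witness adm (admissible-◇ d adm′)
    ... | Π , (Π-prime , A∈ , B∉) , A′∈ =
      Π , (Π-prime , A∈ , B∉) , (Π-prime , A′∈ , admissible-excludes adm′ Π-prime B∉)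

    admissible-refl : T (hasT L) → ∀ {A X} → Admissible A X → ⟦ A , X ⟧ S
    admissible-refl t (boxed □A) = S-prime , ∈-imp (T□ t) □A , ∉-⊥
    admissible-refl t (avoiding r A) = S-prime , Boxed⇒∈ A , refuted r ∘ ∈-imp (T◇ t)
      where
      Boxed⇒∈ : ∀ {A} → Boxed A → S A
      Boxed⇒∈ (inj₁ ⊢A)       = ∈-theorem ⊢A
      Boxed⇒∈ (inj₂ (_ , □A)) = ∈-imp (T□ t) □A

    IsNeighbourhood : SetOfSets → Set₁
    IsNeighbourhood 𝒰 = Σ[ A ∈ Fm ] Σ[ X ∈ Fm ] (Admissible A X × (∀ Π → 𝒰 Π ⇔ ⟦ A , X ⟧ Π))

    -- IsNeighbourhood lives in Set₁; excluded middle resizes it to a Set-valued class.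
    neighbourhoods : ClassOfSets
    neighbourhoods 𝒰 = True (em {P = IsNeighbourhood 𝒰})

    neighbourhood⇒ : ∀ {𝒰} → neighbourhoods 𝒰 → IsNeighbourhood 𝒰
    neighbourhood⇒ {𝒰} = toWitness {a? = em {P = IsNeighbourhood 𝒰}}

    neighbourhood⇐ : ∀ {𝒰} → IsNeighbourhood 𝒰 → neighbourhoods 𝒰
    neighbourhood⇐ {𝒰} = fromWitness {a? = em {P = IsNeighbourhood 𝒰}}

    ⟦⟧-neighbourhood : ∀ {A X} → Admissible A X → neighbourhoods ⟦ A , X ⟧
    ⟦⟧-neighbourhood adm = neighbourhood⇐ (_ , _ , adm , λ _ → ⇔-id _)

    segment : Segment L
    segment = record
      { Σ₀      = S
      ; 𝒞       = neighbourhoods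
      ; primeΣ  = S-prime
      ; primeU  = λ 𝒰 𝒰∈ Π Π∈ → let (_ , _ , _ , 𝒰⇔) = neighbourhood⇒ 𝒰∈ in proj₁ (to (𝒰⇔ Π) Π∈)
      ; box     = λ A □A → ⟦ A , ⊥' ⟧ , ⟦⟧-neighbourhood (boxed □A) , λ _ → proj₁ ∘ proj₂
      ; dia     = dia
      ; inter   = inter
      ; nonempt = nonempt
      ; refl∈   = refl∈
      }
      where
      open Equivalence

      dia : ∀ C → S (◇ C) → ∀ 𝒰 → neighbourhoods 𝒰 → Σ[ Π ∈ FmSet ] (𝒰 Π × Π C)
      dia C ◇C 𝒰 𝒰∈ with neighbourhood⇒ 𝒰∈
      ... | _ , _ , adm , 𝒰⇔ with admissible-witness adm ◇C
      ... | Π , Π∈ , C∈ = Π , from (𝒰⇔ Π) Π∈ , C∈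

      inter : T (hasC L) → ∀ 𝒰 𝒰′ → neighbourhoods 𝒰 → neighbourhoods 𝒰′ →
              Σ[ 𝒰″ ∈ SetOfSets ] (neighbourhoods 𝒰″ × (∀ Π → 𝒰″ Π ⇔ (𝒰 Π × 𝒰′ Π)))
      inter c 𝒰 𝒰′ 𝒰∈ 𝒰′∈ with neighbourhood⇒ 𝒰∈ | neighbourhood⇒ 𝒰′∈
      ... | _ , _ , adm , 𝒰⇔ | _ , _ , adm′ , 𝒰′⇔ with admissible-∩ c adm adm′
      ... | _ , adm″ , X″⇔ =
        (λ Π → 𝒰 Π × 𝒰′ Π) ,
        neighbourhood⇐ (_ , _ , adm″ , λ Π → ⇔-sym (⟦∧⟧⇔ X″⇔) ⇔-∘ (𝒰⇔ Π ×-⇔ 𝒰′⇔ Π)) ,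
        λ _ → ⇔-id _

      nonempt : T (hasD L) → ∀ 𝒰 𝒰′ → neighbourhoods 𝒰 → neighbourhoods 𝒰′ →
                Σ[ Π ∈ FmSet ] (𝒰 Π × 𝒰′ Π)
      nonempt d 𝒰 𝒰′ 𝒰∈ 𝒰′∈ with neighbourhood⇒ 𝒰∈ | neighbourhood⇒ 𝒰′∈
      ... | _ , _ , adm , 𝒰⇔ | _ , _ , adm′ , 𝒰′⇔ with admissible-meet d adm adm′
      ... | Π , Π∈ , Π∈′ = Π , from (𝒰⇔ Π) Π∈ , from (𝒰′⇔ Π) Π∈′

      refl∈ : T (hasT L) → ∀ 𝒰 → neighbourhoods 𝒰 → 𝒰 S
      refl∈ t 𝒰 𝒰∈ with neighbourhood⇒ 𝒰∈
      ... | _ , _ , adm , 𝒰⇔ = from (𝒰⇔ S) (admissible-refl t adm)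

  segment : ∀ {S} → Prime L S → Segment L
  segment S-prime = Construction.segment S-prime ⊥' ⊥ ⊥-elim

  segment-neighbourhood : ∀ {S} (S-prime : Prime L S) {𝒰} → Segment.𝒞 (segment S-prime) 𝒰 →
                          Σ[ A ∈ Fm ] (S (□ A) × (∀ {Π} → Prime L Π → Π A → 𝒰 Π))
  segment-neighbourhood S-prime 𝒰∈ with Construction.neighbourhood⇒ S-prime ⊥' ⊥ ⊥-elim 𝒰∈
  ... | A , _ , Construction.boxed □A , 𝒰⇔ =
    A , □A , λ Π-prime A∈ → Equivalence.from (𝒰⇔ _) (Π-prime , A∈ , PrimeSet.∉-⊥ Π-prime)
  ... | _ , _ , Construction.avoiding () _ , _

  refutingSegment : ∀ {S B} → Prime L S → ¬ S (◇ B) → Segment L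
  refutingSegment {B = B} S-prime ◇B∉ = Construction.segment S-prime B ⊤ (λ _ → ◇B∉)

  refutingSegment-neighbourhood : ∀ {S B} (S-prime : Prime L S) (◇B∉ : ¬ S (◇ B)) →
    Σ[ 𝒰 ∈ SetOfSets ] (Segment.𝒞 (refutingSegment S-prime ◇B∉) 𝒰 × (∀ {Π} → 𝒰 Π → ¬ Π B))
  refutingSegment-neighbourhood {B = B} S-prime ◇B∉ =
    ⟦ ⊤' , B ⟧ , ⟦⟧-neighbourhood (avoiding tt (inj₁ ⊢-id)) , proj₂ ∘ proj₂
    where open Construction S-prime B ⊤ (λ _ → ◇B∉)

module TruthLemma (L : WLogic) (em : ∀ {ℓ} → ExcludedMiddle ℓ) where
  open Derivations L
  open CanonicalSegments L em
  open Equivalence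

  infix 4 _⊩ᶜ_
  _⊩ᶜ_ : Segment L → Fm → Set₁
  _⊩ᶜ_ = _⊩_ (Canonical L)

  ⌊_⌋ : Segment L → FmSet
  ⌊_⌋ = Segment.Σ₀

  Truth : Fm → Set₁
  Truth A = ∀ w → w ⊩ᶜ A ⇔ ⌊ w ⌋ A

  private
    by-contradiction : ∀ {P : Set} → ¬ ¬ P → P
    by-contradiction = em⇒dne em

  truth-∧ : ∀ {B C} → Truth B → Truth C → Truth (B ∧' C)
  truth-∧ B-truth C-truth w = mk⇔
    (λ (w⊩B , w⊩C) → ∈-∧ (to (B-truth w) w⊩B) (to (C-truth w) w⊩C))
    (λ B∧C∈ → from (B-truth w) (∈-imp ax-∧e₁ B∧C∈) , from (C-truth w) (∈-imp ax-∧e₂ B∧C∈))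
    where open PrimeSet (Segment.primeΣ w)

  truth-∨ : ∀ {B C} → Truth B → Truth C → Truth (B ∨' C)
  truth-∨ B-truth C-truth w = mk⇔
    [ ∈-imp ax-∨i₁ ∘ to (B-truth w) , ∈-imp ax-∨i₂ ∘ to (C-truth w) ]
    (Sum.map (from (B-truth w)) (from (C-truth w)) ∘ Prime.disj (Segment.primeΣ w))
    where open PrimeSet (Segment.primeΣ w)

  truth-⇒ : ∀ {B C} → Truth B → Truth C → Truth (B ⇒ C)
  truth-⇒ {B} {C} B-truth C-truth w = mk⇔ forced⇒∈ ∈⇒forced
    where
    w-prime : Prime L ⌊ w ⌋
    w-prime = Segment.primeΣ w

    forced⇒∈ : w ⊩ᶜ (B ⇒ C) → ⌊ w ⌋ (B ⇒ C)
    forced⇒∈ w⊩B⇒C = by-contradiction λ B⇒C∉ →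
      let (Δ , Δ-prime , ⊆Δ , C∉) = lindenbaum em (B⇒C∉ ∘ Prime.closed w-prime ∘ ⊢-deduction)
          v = segment Δ-prime
      in C∉ (to (C-truth v) (w⊩B⇒C v (λ _ → ⊆Δ ∘ inj₁) (from (B-truth v) (⊆Δ (inj₂ refl)))))

    ∈⇒forced : ⌊ w ⌋ (B ⇒ C) → w ⊩ᶜ (B ⇒ C)
    ∈⇒forced B⇒C∈ v w≤v v⊩B =
      from (C-truth v) (PrimeSet.∈-mp (Segment.primeΣ v) (w≤v _ B⇒C∈) (to (B-truth v) v⊩B))

  truth-□ : ∀ {B} → Truth B → Truth (□ B)
  truth-□ {B} B-truth w = mk⇔ forced⇒∈ ∈⇒forced
    where
    w-prime : Prime L ⌊ w ⌋
    w-prime = Segment.primeΣ w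

    forced⇒∈ : w ⊩ᶜ □ B → ⌊ w ⌋ (□ B)
    forced⇒∈ w⊩□B = by-contradiction λ □B∉ →
      let ((𝒰 , 𝒰∈) , 𝒰⊩B) = w⊩□B (segment w-prime) (λ _ → id)
          (A , □A∈ , ⟦A⟧⊆𝒰) = segment-neighbourhood w-prime 𝒰∈
          A⊬B : ¬ (｛ A ｝ ⊢[ L ] B)
          A⊬B = λ A⊢B → □B∉ (PrimeSet.∈-imp w-prime (mon□ (singleton-deduction A⊢B)) □A∈)
          (Π , Π-prime , ⊆Π , B∉) = lindenbaum em A⊬B
          v = segment Π-prime
      in B∉ (to (B-truth v) (𝒰⊩B v (⟦A⟧⊆𝒰 Π-prime (⊆Π refl))))

    ∈⇒forced : ⌊ w ⌋ (□ B) → w ⊩ᶜ □ B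
    ∈⇒forced □B∈ v w≤v =
      let (𝒰 , 𝒰∈ , 𝒰⊆B) = Segment.box v B (w≤v _ □B∈)
      in (𝒰 , 𝒰∈) , λ x x∈ → from (B-truth x) (𝒰⊆B _ x∈)

  truth-◇ : ∀ {B} → Truth B → Truth (◇ B)
  truth-◇ {B} B-truth w = mk⇔ forced⇒∈ ∈⇒forced
    where
    w-prime : Prime L ⌊ w ⌋
    w-prime = Segment.primeΣ w

    forced⇒∈ : w ⊩ᶜ ◇ B → ⌊ w ⌋ (◇ B)
    forced⇒∈ w⊩◇B = by-contradiction λ ◇B∉ →
      let (𝒰 , 𝒰∈ , 𝒰∌B) = refutingSegment-neighbourhood w-prime ◇B∉
          (x , x∈ , x⊩B) = w⊩◇B (refutingSegment w-prime ◇B∉) (λ _ → id) (𝒰 , 𝒰∈)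
      in 𝒰∌B x∈ (to (B-truth x) x⊩B)

    ∈⇒forced : ⌊ w ⌋ (◇ B) → w ⊩ᶜ ◇ B
    ∈⇒forced ◇B∈ v w≤v (𝒰 , 𝒰∈) =
      let (Π , Π∈ , B∈) = Segment.dia v B (w≤v _ ◇B∈) 𝒰 𝒰∈
          x = segment (Segment.primeU v 𝒰 𝒰∈ Π Π∈)
      in x , Π∈ , from (B-truth x) B∈

  truth : ∀ A → Truth A
  truth (atom p) w = mk⇔ lower lift
  truth ⊥'       w = mk⇔ (⊥-elim ∘ lower) (⊥-elim ∘ PrimeSet.∉-⊥ (Segment.primeΣ w))
  truth (B ∧' C)   = truth-∧ (truth B) (truth C)
  truth (B ∨' C)   = truth-∨ (truth B) (truth C)
  truth (B ⇒ C)    = truth-⇒ (truth B) (truth C)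
  truth (□ B)      = truth-□ (truth B)
  truth (◇ B)      = truth-◇ (truth B)

lemma4p9 : (lem : ∀ {ℓ} → ExcludedMiddle ℓ) →
           (L : WLogic) (w : Segment L) (A : Fm) →
           _⊩_ (Canonical L) w A ⇔ Segment.Σ₀ w A
lemma4p9 lem L w A = TruthLemma.truth L lem A w
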